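{- Let $n\ge 2$ and $a\in\mathrm{Part}(n)$. If $a$ is not the maximum element of $\mathrm{Part}(n)$, then $\mathit{NextPartition}(a)$ returns the partition immediately next to $a$ in $\mathrm{Part}(n)$. If $\mathit{NextPartition}(a)$ returns null, then $a$ is the maximum element of $\mathrm{Part}(n)$.
   Context: For an integer $n\ge 2$, $\mathrm{Part}(n)$ is the set of non-decreasing sequences $(a_1,\dots,a_k)$ of positive integers with $k\ge 2$ and $\sum_{i=1}^k a_i=n$. It is totally ordered lexicographically: for distinct $a=(a_i)_k$, $b=(b_i)_m$, let $j$ be the least index $\le\min\{k,m\}$ with $a_j\ne b_j$; then $a<b$ iff $a_j<b_j$. An element $b$ is immediately next to $a$ if $b>a$ and every $c\in\mathrm{Part}(n)$ with $c>a$ satisfies $c\ge b$. Procedure $\mathit{NextPartition}$, on input $a=(a_1,\dots,a_k)\in\mathrm{Part}(n)$ with $n=\sum_i a_i$: - If $a_1\ne\lfloor n/2\rfloor$: - if $a_k-a_{k-1}\le 1$, return $(a_1,\dots,a_{k-2},a_{k-1}+a_k)$; - otherwise, let $c=a_{k-1}+1$, $d=a_k-1$, $q=\lfloor d/c\rfloor$, $r=d-qc$; if $q>1$ return $(a_1,\dots,a_{k-2},\underbrace{c,\dots,c}_{q\text{ times}},c+r)$, and if $q\le 1$ return $(a_1,\dots,a_{k-2},c,d)$. - If $a_1=\lfloor n/2\rfloor$: if $n\ne 3$ return null; if $n=3$, return null if $a_2=\lceil n/2\rceil$, and return $(1,2)$ otherwise. -}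

module Defs where

open import Data.Nat using (ℕ; zero; suc; _+_; _*_; _∸_; _≤_; _<_; _≤ᵇ_; _≡ᵇ_)
open import Data.Nat.DivMod using (_/_)
open import Data.Bool using (Bool; true; false; if_then_else_)
open import Data.List using (List; []; _∷_; _++_; length; replicate)
open import Data.Nat.ListAction using (sum)
open import Data.List.Relation.Unary.All using (All)
open import Data.List.Relation.Unary.Linked using (Linked)
open import Data.Maybe using (Maybe; just; nothing)
open import Data.Product using (_×_)
open import Relation.Binary.PropositionalEquality using (_≡_)

IsPart : ℕ → List ℕ → Set
IsPart n a = Linked _≤_ a × All (λ x → 0 < x) a × 2 ≤ length a × sum a ≡ n

-- the paper's lexicographic strict order: at the least index j ≤ min(k,m)
-- where the sequences differ, a_j < b_j
data _<lex_ : List ℕ → List ℕ → Set where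
  here : ∀ {x y xs ys} → x < y → (x ∷ xs) <lex (y ∷ ys)
  there : ∀ {x xs ys} → xs <lex ys → (x ∷ xs) <lex (x ∷ ys)

_≤lex_ : List ℕ → List ℕ → Set
a ≤lex b = (a <lex b) Data.Sum.⊎ (a ≡ b)
  where import Data.Sum

IsMax : ℕ → List ℕ → Set
IsMax n a = IsPart n a × (∀ c → IsPart n c → c ≤lex a)

ImmNext : ℕ → List ℕ → List ℕ → Set
ImmNext n a b = IsPart n b × a <lex b × (∀ c → IsPart n c → a <lex c → b ≤lex c)

replaceLastTwo : (ℕ → ℕ → List ℕ) → List ℕ → List ℕ
replaceLastTwo f [] = []
replaceLastTwo f (x ∷ []) = x ∷ []
replaceLastTwo f (x ∷ y ∷ []) = f x y
replaceLastTwo f (x ∷ y ∷ z ∷ zs) = x ∷ replaceLastTwo f (y ∷ z ∷ zs)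

lastStep : ℕ → ℕ → List ℕ
lastStep x y =
  if y ≤ᵇ suc x   -- a_k - a_{k-1} ≤ 1 (as integers)
  then (x + y ∷ [])
  else branch
  where
    c = suc x
    d = y ∸ 1
    q = d / c
    r = d ∸ q * c
    branch = if 2 ≤ᵇ q then replicate q c ++ (c + r ∷ []) else (c ∷ d ∷ [])

NextPartition : List ℕ → Maybe (List ℕ)
NextPartition [] = nothing
NextPartition a@(a₁ ∷ _) =
  if a₁ ≡ᵇ (n / 2)
  then (if n ≡ᵇ 3 then second a else nothing)
  else just (replaceLastTwo lastStep a)
  where
    n = sum a
    second : List ℕ → Maybe (List ℕ)
    second (_ ∷ a₂ ∷ _) = if a₂ ≡ᵇ 2 then nothing else just (1 ∷ 2 ∷ [])
    second _ = just (1 ∷ 2 ∷ [])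

-- The successor of a keeps a₁ … a_{k-2} and replaces the tail (a_{k-1}, a_k) by the lexicographically
-- least non-decreasing tail above it. That tail must start with C = a_{k-1} + 1, and the least
-- non-decreasing list with entries ≥ C and sum m = q C + (C + r), r < C, is (C, …, C, C + r):
-- this is what NextPartition computes, a single entry a_{k-1} + a_k being the case q = 0.
-- The result is again a partition unless k = 2 and q = 0, i.e. a = (⌊n/2⌋, ⌈n/2⌉), the maximum;
-- and a₁ = ⌊n/2⌋ forces k = 2 except for a = (1, 1, 1).
module Submission where

open import Data.Bool using (true; false; T)
open import Data.Bool.Properties using (T-≡)
open import Data.Empty using (⊥-elim)
open import Data.List using (List; []; _∷_; _++_; length; replicate)
open import Data.List.Relation.Unary.All using (All; []; _∷_)
open import Data.List.Relation.Unary.Linked using (Linked; [-]; _∷_; tail)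
open import Data.Maybe using (just; nothing)
open import Data.Nat
open import Data.Nat.DivMod
open import Data.Nat.ListAction using (sum)
open import Data.Nat.Properties
open import Data.Product using (_×_; _,_; ∃-syntax)
open import Data.Sum using (inj₁; inj₂)
open import Function using (case_of_)
open import Function.Bundles using (Equivalence)
open import Relation.Nullary using (¬_; yes; no)
open import Relation.Binary.PropositionalEquality

open import Defs

*2≡+ : ∀ m → m * 2 ≡ m + m
*2≡+ m = trans (*-comm m 2) (cong (m +_) (+-identityʳ m))

≤-half : ∀ {m n} → m + m ≤ n → m ≤ n / 2
≤-half {m} {n} m+m≤n = begin
  m          ≡⟨ sym (m*n/n≡m m 2) ⟩
  m * 2 / 2  ≤⟨ /-monoˡ-≤ 2 (subst (_≤ n) (sym (*2≡+ m)) m+m≤n) ⟩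
  n / 2      ∎
  where open ≤-Reasoning

≤1+half+half : ∀ n → n ≤ suc (n / 2 + n / 2)
≤1+half+half n with n ≤? suc (n / 2 + n / 2)
... | yes n≤ = n≤
... | no n≰ = ⊥-elim (<-irrefl refl (≤-half 1+h+1+h≤n))
  where
  h = n / 2
  1+h+1+h≤n : suc h + suc h ≤ n
  1+h+1+h≤n = subst (_≤ n) (cong suc (sym (+-suc h h))) (≰⇒> n≰)

half-close : ∀ {x y} → x ≤ y → y ≤ suc x → (x + y) / 2 ≡ x
half-close {x} {y} x≤y y≤1+x = ≤-antisym (≤-pred (m<n*o⇒m/o<n x+y<2+2x)) (≤-half (+-monoʳ-≤ x x≤y))
  where
  open ≤-Reasoning
  x+y<2+2x : x + y < suc x * 2
  x+y<2+2x = begin-strict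
    x + y              ≤⟨ +-monoʳ-≤ x y≤1+x ⟩
    x + suc x          ≡⟨ +-suc x x ⟩
    suc (x + x)        <⟨ n<1+n _ ⟩
    suc (suc (x + x))  ≡⟨ cong (2 +_) (sym (*2≡+ x)) ⟩
    suc x * 2          ∎

∷-≤lex : ∀ x {b c} → b ≤lex c → (x ∷ b) ≤lex (x ∷ c)
∷-≤lex x (inj₁ b<c) = inj₁ (there b<c)
∷-≤lex x (inj₂ refl) = inj₂ refl

sum≡0⇒[] : ∀ {cs} → All (0 <_) cs → sum cs ≡ 0 → cs ≡ []
sum≡0⇒[] [] _ = refl
sum≡0⇒[] (s≤s _ ∷ _) ()

≤lex-singleton : ∀ {u cs y} → All (0 <_) (u ∷ cs) → sum (u ∷ cs) ≤ y → (u ∷ cs) ≤lex (y ∷ [])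
≤lex-singleton {u} {cs} (_ ∷ pos) sum≤y with m≤n⇒m<n∨m≡n (≤-trans (m≤m+n u (sum cs)) sum≤y)
... | inj₁ u<y = inj₁ (here u<y)
... | inj₂ refl with sum≡0⇒[] pos (n≤0⇒n≡0 (+-cancelˡ-≤ u (sum cs) 0 u+sum≤u+0))
  where
  u+sum≤u+0 : u + sum cs ≤ u + 0
  u+sum≤u+0 = subst (u + sum cs ≤_) (sym (+-identityʳ u)) sum≤y
...   | refl = inj₂ refl

2*head≤sum : ∀ {w u v cs} → Linked _≤_ (w ∷ u ∷ v ∷ cs) → w + w ≤ sum (u ∷ v ∷ cs)
2*head≤sum {w} {u} {v} {cs} (w≤u ∷ u≤v ∷ _) = begin
  w + w             ≤⟨ +-mono-≤ w≤u (≤-trans w≤u u≤v) ⟩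
  u + v             ≤⟨ m≤m+n (u + v) (sum cs) ⟩
  u + v + sum cs    ≡⟨ +-assoc u v (sum cs) ⟩
  sum (u ∷ v ∷ cs)  ∎
  where open ≤-Reasoning

spread : ℕ → ℕ → ℕ → List ℕ
spread C q r = replicate q C ++ (C + r ∷ [])

length-spread : ∀ C q r → length (spread C q r) ≡ suc q
length-spread C zero r = refl
length-spread C (suc q) r = cong suc (length-spread C q r)

sum-spread : ∀ C q r → sum (spread C q r) ≡ q * C + (C + r)
sum-spread C zero r = +-identityʳ (C + r)
sum-spread C (suc q) r = trans (cong (C +_) (sum-spread C q r)) (sym (+-assoc C (q * C) (C + r)))

spread-linked : ∀ {w C} q r → w ≤ C → Linked _≤_ (w ∷ spread C q r)
spread-linked {C = C} zero r w≤C = ≤-trans w≤C (m≤m+n C r) ∷ [-]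
spread-linked (suc q) r w≤C = w≤C ∷ spread-linked q r ≤-refl

spread-pos : ∀ {C} q r → 0 < C → All (0 <_) (spread C q r)
spread-pos {C} zero r 0<C = ≤-trans 0<C (m≤m+n C r) ∷ []
spread-pos (suc q) r 0<C = 0<C ∷ spread-pos q r 0<C

spread-least : ∀ {C r} q {c} → r < C → Linked _≤_ (C ∷ c) → sum c ≡ q * C + (C + r) → spread C q r ≤lex c
spread-least zero {[]} (s≤s _) _ ()
spread-least zero {u ∷ []} _ _ u+0≡C+r = inj₂ (cong (_∷ []) (sym (trans (sym (+-identityʳ u)) u+0≡C+r)))
spread-least {C} {r} zero {u ∷ v ∷ cs} r<C sorted sum≡ =
  ⊥-elim (<⇒≱ (+-monoʳ-< C r<C) (≤-trans (2*head≤sum sorted) (≤-reflexive sum≡)))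
spread-least (suc q) {[]} (s≤s _) _ ()
spread-least {C} {r} (suc q) {u ∷ cs} r<C (C≤u ∷ sorted) sum≡ with m≤n⇒m<n∨m≡n C≤u
... | inj₁ C<u = inj₁ (here C<u)
... | inj₂ refl =
  ∷-≤lex C (spread-least q r<C sorted (+-cancelˡ-≡ C _ _ (trans sum≡ (+-assoc C (q * C) (C + r)))))

data IsSpread (C m : ℕ) : List ℕ → Set where
  isSpread : ∀ q r → r < C → q * C + (C + r) ≡ m → IsSpread C m (spread C q r)

isSpread-linked : ∀ {w C m b} → w ≤ C → IsSpread C m b → Linked _≤_ (w ∷ b)
isSpread-linked w≤C (isSpread q r _ _) = spread-linked q r w≤C

isSpread-pos : ∀ {C m b} → IsSpread C m b → All (0 <_) b
isSpread-pos (isSpread q r r<C _) = spread-pos q r (≤-trans (s≤s z≤n) r<C)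

isSpread-sum : ∀ {C m b} → IsSpread C m b → sum b ≡ m
isSpread-sum (isSpread q r _ eq) = trans (sum-spread _ q r) eq

isSpread-> : ∀ {C m b x ys} → x < C → IsSpread C m b → (x ∷ ys) <lex b
isSpread-> {C} x<C (isSpread zero r _ _) = here (≤-trans x<C (m≤m+n C r))
isSpread-> x<C (isSpread (suc q) r _ _) = here x<C

isSpread-least : ∀ {C m b c} → IsSpread C m b → Linked _≤_ (C ∷ c) → sum c ≡ m → b ≤lex c
isSpread-least (isSpread q r r<C eq) sorted sum≡ = spread-least q r<C sorted (trans sum≡ (sym eq))

div-isSpread : ∀ x y → IsSpread (suc x) (x + suc y) (spread (suc x) (y / suc x) (y ∸ (y / suc x) * suc x))
div-isSpread x y = isSpread q r r<C (begin
    q * C + (C + r)  ≡⟨ +-comm (q * C) (C + r) ⟩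
    C + r + q * C    ≡⟨ +-assoc C r (q * C) ⟩
    C + (r + q * C)  ≡⟨ cong (λ t → C + (t + q * C)) r≡y%C ⟩
    C + (y % C + q * C) ≡⟨ cong (C +_) (sym (m≡m%n+[m/n]*n y C)) ⟩
    C + y            ≡⟨ sym (+-suc x y) ⟩
    x + suc y        ∎)
  where
  open ≡-Reasoning
  C = suc x
  q = y / C
  r = y ∸ q * C
  r≡y%C : r ≡ y % C
  r≡y%C = sym (m%n≡m∸m/n*n y C)
  r<C : r < C
  r<C = subst (_< C) (sym r≡y%C) (m%n<n y C)

spread-one : ∀ C d q → q ≡ 1 → C ≤ d → spread C q (d ∸ q * C) ≡ C ∷ d ∷ []
spread-one C d .1 refl C≤d rewrite +-identityʳ C | m+[n∸m]≡n C≤d = refl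

-- The merge branch is the spread with q = 0, the branch (c , d) the one with q = 1.
lastStep-isSpread : ∀ x y → IsSpread (suc x) (x + suc y) (lastStep x (suc y))
lastStep-isSpread x y with suc y ≤ᵇ suc x in merge
... | true =
  subst (IsSpread (suc x) (x + suc y)) (cong (_∷ []) (sym (+-suc x y))) (isSpread 0 y y<C (sym (+-suc x y)))
  where
  y<C : y < suc x
  y<C = ≤ᵇ⇒≤ (suc y) (suc x) (Equivalence.from T-≡ merge)
... | false with 2 ≤ᵇ y / suc x in many
...   | true = div-isSpread x y
...   | false = subst (IsSpread (suc x) (x + suc y)) (spread-one (suc x) y q q≡1 C≤y) (div-isSpread x y)
  where
  q = y / suc x
  C≤y : suc x ≤ y
  C≤y = ≤-pred (≰⇒> (λ le → subst T merge (≤⇒≤ᵇ le)))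
  q≡1 : q ≡ 1
  q≡1 = ≤-antisym (≤-pred (≰⇒> (λ le → subst T many (≤⇒≤ᵇ le)))) (m≥n⇒m/n>0 C≤y)

nextPart : List ℕ → List ℕ
nextPart = replaceLastTwo lastStep

nextPart-linked : ∀ {w} x y zs → All (0 <_) (x ∷ y ∷ zs) → Linked _≤_ (w ∷ x ∷ y ∷ zs) →
                  Linked _≤_ (w ∷ nextPart (x ∷ y ∷ zs))
nextPart-linked x zero [] (_ ∷ () ∷ _) _
nextPart-linked x (suc y) [] _ (w≤x ∷ _) = isSpread-linked (≤-trans w≤x (n≤1+n x)) (lastStep-isSpread x y)
nextPart-linked x y (z ∷ zs) (_ ∷ pos) (w≤x ∷ sorted) = w≤x ∷ nextPart-linked y z zs pos sorted

nextPart-pos : ∀ x y zs → All (0 <_) (x ∷ y ∷ zs) → All (0 <_) (nextPart (x ∷ y ∷ zs))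
nextPart-pos x zero [] (_ ∷ () ∷ _)
nextPart-pos x (suc y) [] _ = isSpread-pos (lastStep-isSpread x y)
nextPart-pos x y (z ∷ zs) (0<x ∷ pos) = 0<x ∷ nextPart-pos y z zs pos

sum-nextPart : ∀ x y zs → All (0 <_) (x ∷ y ∷ zs) → sum (nextPart (x ∷ y ∷ zs)) ≡ sum (x ∷ y ∷ zs)
sum-nextPart x zero [] (_ ∷ () ∷ _)
sum-nextPart x (suc y) [] _ =
  trans (isSpread-sum (lastStep-isSpread x y)) (cong (x +_) (sym (+-identityʳ (suc y))))
sum-nextPart x y (z ∷ zs) (_ ∷ pos) = cong (x +_) (sum-nextPart y z zs pos)

<lex-nextPart : ∀ x y zs → All (0 <_) (x ∷ y ∷ zs) → (x ∷ y ∷ zs) <lex nextPart (x ∷ y ∷ zs)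
<lex-nextPart x zero [] (_ ∷ () ∷ _)
<lex-nextPart x (suc y) [] _ = isSpread-> ≤-refl (lastStep-isSpread x y)
<lex-nextPart x y (z ∷ zs) (_ ∷ pos) = there (<lex-nextPart y z zs pos)

nextPart-least : ∀ x y zs {c} → All (0 <_) (x ∷ y ∷ zs) → Linked _≤_ c → sum c ≡ sum (x ∷ y ∷ zs) →
                 (x ∷ y ∷ zs) <lex c → nextPart (x ∷ y ∷ zs) ≤lex c
nextPart-least x zero [] (_ ∷ () ∷ _) _ _ _
nextPart-least x (suc y) [] {u ∷ cs} _ sorted sum≡ (here x<u) =
  isSpread-least (lastStep-isSpread x y) (x<u ∷ sorted) (trans sum≡ (cong (x +_) (+-identityʳ (suc y))))
nextPart-least x (suc y) [] {.x ∷ v ∷ cs} _ _ sum≡ (there (here y<v)) =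
  ⊥-elim (<⇒≱ y<v (≤-trans (m≤m+n v (sum cs)) (≤-reflexive tail-sum≡y)))
  where
  tail-sum≡y : sum (v ∷ cs) ≡ suc y
  tail-sum≡y = trans (+-cancelˡ-≡ x _ _ sum≡) (+-identityʳ (suc y))
nextPart-least x (suc y) [] {.x ∷ .(suc y) ∷ cs} _ _ _ (there (there ()))
nextPart-least x y (z ∷ zs) _ _ _ (here x<u) = inj₁ (here x<u)
nextPart-least x y (z ∷ zs) (_ ∷ pos) sorted sum≡ (there a<c) =
  ∷-≤lex x (nextPart-least y z zs pos (tail sorted) (+-cancelˡ-≡ x _ _ sum≡) a<c)

nextPart-immNext : ∀ {n a} → IsPart n a → 2 ≤ length (nextPart a) → ImmNext n a (nextPart a)
nextPart-immNext {a = []} (_ , _ , () , _) _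
nextPart-immNext {a = _ ∷ []} (_ , _ , s≤s () , _) _
nextPart-immNext {a = x ∷ y ∷ zs} (sorted , pos , _ , sum≡n) len =
  ( tail (nextPart-linked x y zs pos (z≤n ∷ sorted)) , nextPart-pos x y zs pos , len
  , trans (sum-nextPart x y zs pos) sum≡n ) ,
  <lex-nextPart x y zs pos ,
  λ c (sortedᶜ , _ , _ , sumᶜ≡n) a<c → nextPart-least x y zs pos sortedᶜ (trans sumᶜ≡n (sym sum≡n)) a<c

nextPart-nonempty : ∀ x y zs → All (0 <_) (x ∷ y ∷ zs) → 1 ≤ length (nextPart (x ∷ y ∷ zs))
nextPart-nonempty x zero [] (_ ∷ () ∷ _)
nextPart-nonempty x (suc y) [] _ with lastStep x (suc y) | lastStep-isSpread x y
... | _ | isSpread q r _ _ = subst (1 ≤_) (sym (length-spread (suc x) q r)) (s≤s z≤n)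
nextPart-nonempty x y (z ∷ zs) _ = s≤s z≤n

lastStep-length : ∀ x y → x ≤ suc y → x ≢ sum (x ∷ suc y ∷ []) / 2 → 2 ≤ length (lastStep x (suc y))
lastStep-length x y x≤1+y off with lastStep x (suc y) | lastStep-isSpread x y
... | _ | isSpread (suc q) r _ _ = subst (2 ≤_) (sym (length-spread (suc x) (suc q) r)) (s≤s (s≤s z≤n))
... | _ | isSpread zero r r<C eq = ⊥-elim (off (sym (begin
  (x + (suc y + 0)) / 2  ≡⟨ cong (λ t → (x + t) / 2) (+-identityʳ (suc y)) ⟩
  (x + suc y) / 2        ≡⟨ half-close x≤1+y (subst (_≤ suc x) 1+r≡1+y r<C) ⟩
  x                      ∎)))
  where
  open ≡-Reasoning
  1+r≡1+y : suc r ≡ suc y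
  1+r≡1+y = +-cancelˡ-≡ x _ _ (trans (+-suc x r) eq)

pair-isMax : ∀ {n x y} → IsPart n (x ∷ y ∷ []) → x ≡ n / 2 → IsMax n (x ∷ y ∷ [])
pair-isMax {n} {x} {y} P@(_ , _ , _ , sum≡n) x≡half = P , below
  where
  below : ∀ c → IsPart n c → c ≤lex (x ∷ y ∷ [])
  below [] (_ , _ , () , _)
  below (_ ∷ []) (_ , _ , s≤s () , _)
  below (u ∷ v ∷ cs) (u≤v ∷ _ , _ ∷ pos , _ , sumᶜ≡n) with m≤n⇒m<n∨m≡n u≤x
    where
    u≤x : u ≤ x
    u≤x = subst (u ≤_) (sym x≡half) (≤-half (≤-trans (+-monoʳ-≤ u u≤v)
            (≤-trans (m≤m+n (u + v) (sum cs)) (≤-reflexive (trans (+-assoc u v (sum cs)) sumᶜ≡n)))))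
  ... | inj₁ u<x = inj₁ (here u<x)
  ... | inj₂ refl = ∷-≤lex u (≤lex-singleton pos (≤-reflexive tail-sum≡y))
    where
    tail-sum≡y : sum (v ∷ cs) ≡ y
    tail-sum≡y = trans (+-cancelˡ-≡ u _ _ (trans sumᶜ≡n (sym sum≡n))) (+-identityʳ y)

parts≤2 : ∀ y z S → 0 < y → y ≤ z → y + (z + S) ≤ 2 → y ≡ 1 × z ≡ 1 × S ≡ 0
parts≤2 1 1 0 _ _ _ = refl , refl , refl
parts≤2 1 1 (suc S) _ _ (s≤s (s≤s ()))
parts≤2 1 (suc (suc z)) S _ _ (s≤s (s≤s ()))
parts≤2 (suc (suc y)) 1 S _ (s≤s ()) _
parts≤2 (suc (suc y)) (suc (suc z)) S _ _ (s≤s (s≤s y+≤0)) with m+n≤o⇒n≤o y y+≤0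
... | ()

parts-of-3 : ∀ {x y z S} → 0 < x → x ≤ y → y ≤ z → x + (y + (z + S)) ≤ suc (x + x) →
             x ≡ 1 × y ≡ 1 × z ≡ 1 × S ≡ 0
parts-of-3 {x} {y} {z} {S} 0<x x≤y y≤z bound with ≤-antisym x≤1 0<x
  where
  open ≤-Reasoning
  x≤1 : x ≤ 1
  x≤1 = +-cancelˡ-≤ (x + x) x 1 (begin
    x + x + x          ≡⟨ +-comm (x + x) x ⟩
    x + (x + x)        ≤⟨ +-monoʳ-≤ x (+-mono-≤ x≤y (≤-trans (≤-trans x≤y y≤z) (m≤m+n z S))) ⟩
    x + (y + (z + S))  ≤⟨ bound ⟩
    suc (x + x)        ≡⟨ +-comm 1 (x + x) ⟩
    x + x + 1          ∎)
... | refl = refl , parts≤2 y z S x≤y y≤z (≤-pred bound)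

at-half-three-parts : ∀ {n x y z zs} → IsPart n (x ∷ y ∷ z ∷ zs) → x ≡ n / 2 →
                      _≡_ {A = List ℕ} (x ∷ y ∷ z ∷ zs) (1 ∷ 1 ∷ 1 ∷ [])
at-half-three-parts {n} {x} (x≤y ∷ y≤z ∷ _ , 0<x ∷ _ ∷ _ ∷ pos , _ , sum≡n) x≡half
  with parts-of-3 0<x x≤y y≤z (subst₂ (λ m h → m ≤ suc (h + h)) (sym sum≡n) (sym x≡half) (≤1+half+half n))
... | refl , refl , refl , sum≡0 with sum≡0⇒[] pos sum≡0
...   | refl = refl

NextPartition-off-half : ∀ x rest → x ≢ sum (x ∷ rest) / 2 →
                         NextPartition (x ∷ rest) ≡ just (nextPart (x ∷ rest))
NextPartition-off-half x rest off with x ≡ᵇ sum (x ∷ rest) / 2 in at-half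
... | false = refl
... | true = ⊥-elim (off (≡ᵇ⇒≡ x _ (Equivalence.from T-≡ at-half)))

pair-half-of-3 : ∀ {x y} → x ≡ sum (x ∷ y ∷ []) / 2 → sum (x ∷ y ∷ []) ≡ 3 → y ≡ 2
pair-half-of-3 {x} {y} x≡half sum≡3 =
  trans (sym (+-identityʳ y)) (+-cancelˡ-≡ 1 _ _ (subst (λ t → t + (y + 0) ≡ 3) x≡1 sum≡3))
  where
  x≡1 : x ≡ 1
  x≡1 = trans x≡half (cong (_/ 2) sum≡3)

NextPartition-pair-half : ∀ x y → x ≡ sum (x ∷ y ∷ []) / 2 → NextPartition (x ∷ y ∷ []) ≡ nothing
NextPartition-pair-half x y x≡half with x ≡ᵇ sum (x ∷ y ∷ []) / 2 in at-half
... | false = ⊥-elim (subst T at-half (≡⇒≡ᵇ x _ x≡half))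
... | true with sum (x ∷ y ∷ []) ≡ᵇ 3 in n≡3
...   | false = refl
...   | true rewrite pair-half-of-3 x≡half (≡ᵇ⇒≡ _ 3 (Equivalence.from T-≡ n≡3)) = refl

data NextView (n : ℕ) (a : List ℕ) : Set where
  final : NextPartition a ≡ nothing → IsMax n a → NextView n a
  step  : NextPartition a ≡ just (nextPart a) → 2 ≤ length (nextPart a) → NextView n a

nextView : ∀ {n} a → IsPart n a → NextView n a
nextView [] (_ , _ , () , _)
nextView (_ ∷ []) (_ , _ , s≤s () , _)
nextView (x ∷ zero ∷ []) (_ , _ ∷ () ∷ _ , _)
nextView (x ∷ suc y ∷ []) P@(x≤y ∷ _ , _ , _ , sum≡n) with x ≟ sum (x ∷ suc y ∷ []) / 2
... | no off = step (NextPartition-off-half x _ off) (lastStep-length x y x≤y off)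
... | yes x≡half =
  final (NextPartition-pair-half x (suc y) x≡half) (pair-isMax P (trans x≡half (cong (_/ 2) sum≡n)))
nextView (x ∷ y ∷ z ∷ zs) P@(_ , _ ∷ pos , _ , sum≡n) with x ≟ sum (x ∷ y ∷ z ∷ zs) / 2
... | no off = step (NextPartition-off-half x (y ∷ z ∷ zs) off) (s≤s (nextPart-nonempty y z zs pos))
... | yes x≡half with at-half-three-parts P (trans x≡half (cong (_/ 2) sum≡n))
...   | refl = step refl (s≤s (s≤s z≤n))

-- The hypothesis 2 ≤ n is implied by IsPart n a.
theorem1 : (n : ℕ) → 2 ≤ n → (a : List ℕ) → IsPart n a →
    (¬ IsMax n a → ∃[ b ] (NextPartition a ≡ just b × ImmNext n a b)) ×
    (NextPartition a ≡ nothing → IsMax n a)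
theorem1 n _ a P with nextView a P
... | final _ max = (λ ¬max → ⊥-elim (¬max max)) , λ _ → max
... | step next len =
  (λ _ → nextPart a , next , nextPart-immNext P len) , λ none → case trans (sym next) none of λ ()
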